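{- Let $\Delta$ be a positive integer and let $G$ be a fuzzy long circular interval graph of maximum degree at most $\Delta$. Then $\mathrm{tw}(G)\le 4\Delta+3$.
   Context: Given a graph $H$, a set $F$ of unordered pairs of vertices of $H$ is valid if every vertex of $H$ belongs to at most one member of $F$. A graph $G$ is a thickening of $(H,F)$ if there are nonempty pairwise disjoint sets $X_v\subseteq V(G)$ ($v\in V(H)$) with union $V(G)$ such that: each $X_v$ is a clique; if $uv\in E(H)$ and $\{u,v\}\notin F$ then $X_u$ is complete to $X_v$; if $u,v$ are nonadjacent in $H$ and $\{u,v\}\notin F$ then $X_u$ is anticomplete to $X_v$; if $\{u,v\}\in F$ then $X_u$ is neither complete nor anticomplete to $X_v$. Let $\Sigma$ be a circle and $I_1,\dots,I_k\subseteq\Sigma$ each homeomorphic to $[0,1]$, no two sharing an endpoint, no three with union $\Sigma$. A long circular interval graph is a graph $H$ with $V(H)$ a finite subset of $\Sigma$ in which distinct $u,v$ are adjacent iff $u,v\in I_i$ for some $i$. Let $F'$ be the set of pairs $\{u,v\}$ of distinct vertices of $H$ that are the endpoints of some $I_i$ such that no $j\neq i$ has $u,v\in I_j$, and let $F\subseteq F'$. Any thickening of such $(H,F)$ is a fuzzy long circular interval graph. $\mathrm{tw}$ is treewidth.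
   Formalization: The circle Σ is taken as the rationals in [0,1) with 0 and 1 identified, so the vertices of H and the endpoints of the arcs lie at rational points. -}

module Defs where

open import Data.Nat using (ℕ; zero; suc; _≤_; _+_)
open import Data.Fin using (Fin; toℕ; zero; suc)
open import Data.Fin.Subset using (Subset; ∣_∣)
open import Data.Vec using (tabulate; lookup)
open import Data.Bool using (Bool; true; false)
open import Data.Rational using (ℚ; 0ℚ; 1ℚ) renaming (_≤_ to _≤ℚ_; _<_ to _<ℚ_)
open import Data.Product using (Σ; _×_; _,_; ∃)
open import Data.Sum using (_⊎_)
open import Relation.Binary.PropositionalEquality using (_≡_; _≢_)
open import Relation.Nullary using (¬_)

record Graph : Set where
  field
    size   : ℕ
    adj    : Fin size → Fin size → Bool
    sym    : ∀ x y → adj x y ≡ adj y x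
    irrefl : ∀ x → adj x x ≡ false

open Graph public

Adj : (G : Graph) → Fin (size G) → Fin (size G) → Set
Adj G x y = adj G x y ≡ true

degree : (G : Graph) → Fin (size G) → ℕ
degree G x = ∣ tabulate (adj G x) ∣

MaxDegreeAtMost : Graph → ℕ → Set
MaxDegreeAtMost G Δ = ∀ x → degree G x ≤ Δ

-- A tree with node set Fin (suc m) is given by a parent function:
-- node (suc i) has parent (parent i), whose index is at most i.
-- (Every finite nonempty tree arises this way, e.g. in BFS order.)

record Tree : Set where
  field
    m        : ℕ
    parent   : Fin m → Fin (suc m)
    parent≤  : ∀ i → toℕ (parent i) ≤ toℕ i

open Tree public

TreeAdj : (T : Tree) → Fin (suc (m T)) → Fin (suc (m T)) → Set
TreeAdj T s t = (∃ λ i → s ≡ suc i × t ≡ parent T i)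
              ⊎ (∃ λ i → t ≡ suc i × s ≡ parent T i)

data WalkIn (T : Tree) (S : Fin (suc (m T)) → Set)
     : Fin (suc (m T)) → Fin (suc (m T)) → Set where
  here : ∀ {s} → S s → WalkIn T S s s
  step : ∀ {s t u} → S s → TreeAdj T s t → WalkIn T S t u → WalkIn T S s u

ConnectedIn : (T : Tree) → (Fin (suc (m T)) → Set) → Set
ConnectedIn T S = ∀ s t → S s → S t → WalkIn T S s t

record TreeDecomposition (G : Graph) : Set where
  field
    tree     : Tree
    bag      : Fin (suc (m tree)) → Subset (size G)
    covers   : ∀ x → ∃ λ t → lookup (bag t) x ≡ true
    edges    : ∀ x y → Adj G x y →
               ∃ λ t → (lookup (bag t) x ≡ true) × (lookup (bag t) y ≡ true)
    coherent : ∀ x → ConnectedIn tree (λ t → lookup (bag t) x ≡ true)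

open TreeDecomposition public

WidthAtMost : {G : Graph} → TreeDecomposition G → ℕ → Set
WidthAtMost D w = ∀ t → ∣ bag D t ∣ ≤ w + 1

TreewidthAtMost : Graph → ℕ → Set
TreewidthAtMost G w = Σ (TreeDecomposition G) λ D → WidthAtMost D w

-- The circle Σ is modelled as the rationals in [0,1) (identifying 1 with 0).
-- An arc homeomorphic to [0,1] is given by its endpoints a ≠ b and consists
-- of the points met going from a in the increasing direction (wrapping at 1)
-- until b.

InCircle : ℚ → Set
InCircle x = (0ℚ ≤ℚ x) × (x <ℚ 1ℚ)

InArc : ℚ → ℚ → ℚ → Set
InArc a b x = ((a ≤ℚ x) × (x ≤ℚ b)) ⊎ ((b <ℚ a) × ((a ≤ℚ x) ⊎ (x ≤ℚ b)))

record LongCircularIntervalModel (n : ℕ) : Set where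
  field
    pos       : Fin n → ℚ
    posCircle : ∀ v → InCircle (pos v)
    posInj    : ∀ u v → pos u ≡ pos v → u ≡ v
    k         : ℕ
    left      : Fin k → ℚ
    right     : Fin k → ℚ
    leftC     : ∀ i → InCircle (left i)
    rightC    : ∀ i → InCircle (right i)
    nondeg    : ∀ i → left i ≢ right i
    noShareLL : ∀ i j → i ≢ j → left i ≢ left j
    noShareLR : ∀ i j → i ≢ j → left i ≢ right j
    noShareRR : ∀ i j → i ≢ j → right i ≢ right j
    noThree   : ∀ i j l → i ≢ j → j ≢ l → i ≢ l →
                ¬ (∀ x → InCircle x →
                     InArc (left i) (right i) x
                   ⊎ InArc (left j) (right j) x
                   ⊎ InArc (left l) (right l) x)

open LongCircularIntervalModel public

module _ {n : ℕ} (M : LongCircularIntervalModel n) where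

  InI : Fin (k M) → Fin n → Set
  InI i v = InArc (left M i) (right M i) (pos M v)

  AdjH : Fin n → Fin n → Set
  AdjH u v = (u ≢ v) × (∃ λ i → InI i u × InI i v)

  InF' : Fin n → Fin n → Set
  InF' u v = (u ≢ v) × (∃ λ i →
               (((pos M u ≡ left M i) × (pos M v ≡ right M i))
                ⊎ ((pos M u ≡ right M i) × (pos M v ≡ left M i)))
             × (∀ j → j ≢ i → ¬ (InI j u × InI j v)))

-- Thickenings. A set F of unordered pairs is given by a relation F,
-- {u,v} ∈ F meaning F u v ⊎ F v u.

PairIn : {n : ℕ} → (Fin n → Fin n → Set) → Fin n → Fin n → Set
PairIn F u v = F u v ⊎ F v u

Valid : {n : ℕ} → (Fin n → Fin n → Set) → Set
Valid F = ∀ u v w → PairIn F u v → PairIn F u w → v ≡ w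

-- G is a thickening of (H,F); X_v = φ⁻¹(v)
IsThickening : (G : Graph) (n : ℕ) (AdjH' : Fin n → Fin n → Set)
               (F : Fin n → Fin n → Set) → Set
IsThickening G n AdjH' F = Σ (Fin (size G) → Fin n) λ φ →
    (∀ v → ∃ λ x → φ x ≡ v)
  × (∀ x y → x ≢ y → φ x ≡ φ y → Adj G x y)
  × (∀ x y → φ x ≢ φ y → AdjH' (φ x) (φ y) →
       ¬ PairIn F (φ x) (φ y) → Adj G x y)
  × (∀ x y → φ x ≢ φ y → ¬ AdjH' (φ x) (φ y) →
       ¬ PairIn F (φ x) (φ y) → ¬ Adj G x y)
  × (∀ u v → PairIn F u v →
       (∃ λ x → ∃ λ y → φ x ≡ u × φ y ≡ v × Adj G x y)
     × (∃ λ x → ∃ λ y → φ x ≡ u × φ y ≡ v × ¬ Adj G x y))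

FuzzyLongCircularIntervalGraph : Graph → Set₁
FuzzyLongCircularIntervalGraph G =
  Σ ℕ λ n → Σ (LongCircularIntervalModel n) λ M →
  Σ (Fin n → Fin n → Set) λ F →
    (∀ u v → F u v → InF' M u v)
  × Valid F
  × IsThickening G n (AdjH M) F

-- Cut the circle open at the position of a vertex v₀ of H and rank the vertices of H
-- in the resulting linear order.  On the path with one node per rank, let bag t consist
-- of the vertices of G lying over N_H[v₀] and over every u with rank u ≤ t ≤ rank w for
-- some w ∈ N_H[u].  An interval containing such u and w either contains v₀, which puts
-- u in N_H[v₀], or is an interval of the cut circle and then contains the vertex v_t of
-- rank t; so bag t lies over N_H[v₀] ∪ N_H[v_t].  In a thickening of maximum degree Δ
-- at most 2Δ + 2 vertices lie over a closed neighbourhood N_H[v]: for a fixed x ∈ X_v,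
-- those outside N_G[x] all lie in the single blob X_u with {u,v} ∈ F (F is a matching),
-- and X_u is a clique.  Hence every bag has at most 4Δ + 4 vertices.
module Submission where

open import Defs
open import Data.Nat using (ℕ; _≤_; _+_; _*_)
open import Level using (Level; 0ℓ)
open import Data.Nat as ℕ using (zero; suc; z≤n; s≤s)
import Data.Nat.Properties as ℕ
open import Data.Nat.Tactic.RingSolver using (solve-∀)
open import Data.Fin as Fin using (Fin; zero; suc; toℕ; inject₁; fromℕ<; punchOut)
import Data.Fin.Properties as Fin
open import Data.Fin.Induction using (<-weakInduction)
open import Data.Fin.Subset using (Subset; ∣_∣; _⊆_; _⊂_; _∪_; ⁅_⁆; _∈_; Empty)
open import Data.Fin.Subset.Properties
  using (p⊆q⇒∣p∣≤∣q∣; p⊂q⇒∣p∣<∣q∣; x∈⁅x⁆; x∈p∪q⁺; nonempty?; Empty-unique; ∣⊥∣≡0; ∣⁅x⁆∣≡1; ∣⊤∣≡n; ⊆⊤; ∈⊤)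
open import Data.Vec using ([]; _∷_; tabulate; lookup)
open import Data.Vec.Properties using (lookup∘tabulate; []=⇒lookup; lookup⇒[]=)
open import Data.Bool using (true; false)
open import Data.Rational using (ℚ) renaming (_≤_ to _≤ℚ_; _<_ to _<ℚ_)
import Data.Rational.Properties as ℚ
open import Data.Product using (_×_; _,_; ∃; proj₁; proj₂)
open import Data.Sum using (_⊎_; inj₁; inj₂)
import Data.Empty as Empty
open import Function using (_∘_)
open import Function.Definitions using (Injective)
open import Relation.Nullary using (¬_; Dec; yes; no; does; contradiction)
open import Relation.Nullary.Decidable using (dec-true; _×-dec_; _⊎-dec_; ¬?)
open import Relation.Binary.Bundles using (DecTotalOrder)
open import Relation.Binary.Definitions using (Transitive; Symmetric; Antisymmetric; Total; Decidable)
open import Relation.Binary.PropositionalEquality as ≡ using (_≡_; _≢_; refl; trans; cong; subst)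

private variable ℓ : Level

subset : ∀ {n} {P : Fin n → Set ℓ} → (∀ x → Dec (P x)) → Subset n
subset P? = tabulate (does ∘ P?)

module _ {n} {P : Fin n → Set ℓ} (P? : ∀ x → Dec (P x)) where

  lookup-subset⁺ : ∀ {x} → P x → lookup (subset P?) x ≡ true
  lookup-subset⁺ {x} px = trans (lookup∘tabulate _ x) (dec-true (P? x) px)

  lookup-subset⁻ : ∀ {x} → lookup (subset P?) x ≡ true → P x
  lookup-subset⁻ {x} e with P? x | lookup∘tabulate (does ∘ P?) x
  ... | yes px | _  = px
  ... | no  _  | eq with () ← trans (≡.sym eq) e

  ∈-subset⁺ : ∀ {x} → P x → x ∈ subset P?
  ∈-subset⁺ px = lookup⇒[]= _ _ (lookup-subset⁺ px)

  ∈-subset⁻ : ∀ {x} → x ∈ subset P? → P x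
  ∈-subset⁻ x∈ = lookup-subset⁻ ([]=⇒lookup x∈)

∣p∪q∣≤∣p∣+∣q∣ : ∀ {n} (p q : Subset n) → ∣ p ∪ q ∣ ≤ ∣ p ∣ + ∣ q ∣
∣p∪q∣≤∣p∣+∣q∣ []          []          = z≤n
∣p∪q∣≤∣p∣+∣q∣ (true ∷ p)  (true ∷ q)  = s≤s (ℕ.≤-trans (∣p∪q∣≤∣p∣+∣q∣ p q) (ℕ.+-monoʳ-≤ ∣ p ∣ (ℕ.n≤1+n _)))
∣p∪q∣≤∣p∣+∣q∣ (true ∷ p)  (false ∷ q) = s≤s (∣p∪q∣≤∣p∣+∣q∣ p q)
∣p∪q∣≤∣p∣+∣q∣ (false ∷ p) (true ∷ q)  =
  ℕ.≤-trans (s≤s (∣p∪q∣≤∣p∣+∣q∣ p q)) (ℕ.≤-reflexive (≡.sym (ℕ.+-suc ∣ p ∣ ∣ q ∣)))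
∣p∪q∣≤∣p∣+∣q∣ (false ∷ p) (false ∷ q) = ∣p∪q∣≤∣p∣+∣q∣ p q

∣Empty∣≡0 : ∀ {n} {p : Subset n} → Empty p → ∣ p ∣ ≡ 0
∣Empty∣≡0 {n} empty = trans (cong ∣_∣ (Empty-unique empty)) (∣⊥∣≡0 n)

Adj-sym : (G : Graph) → ∀ {x y} → Adj G x y → Adj G y x
Adj-sym G {x} {y} xy = trans (Graph.sym G y x) xy

IsClique : (G : Graph) → Subset (size G) → Set
IsClique G Q = ∀ {a b} → a ∈ Q → b ∈ Q → a ≢ b → Adj G a b

module BoundedDegree (G : Graph) {Δ : ℕ} (deg : MaxDegreeAtMost G Δ) where

  closedNbhd : Fin (size G) → Subset (size G)
  closedNbhd x = ⁅ x ⁆ ∪ tabulate (adj G x)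

  ∣closedNbhd∣≤1+Δ : ∀ x → ∣ closedNbhd x ∣ ≤ suc Δ
  ∣closedNbhd∣≤1+Δ x = ℕ.≤-trans (∣p∪q∣≤∣p∣+∣q∣ ⁅ x ⁆ _)
    (ℕ.≤-trans (ℕ.≤-reflexive (cong (_+ degree G x) (∣⁅x⁆∣≡1 x))) (s≤s (deg x)))

  ∈closedNbhd : ∀ {x y} → x ≡ y ⊎ Adj G x y → y ∈ closedNbhd x
  ∈closedNbhd {x} (inj₁ refl) = x∈p∪q⁺ (inj₁ (x∈⁅x⁆ x))
  ∈closedNbhd {x} {y} (inj₂ xy) =
    x∈p∪q⁺ (inj₂ (lookup⇒[]= y _ (trans (lookup∘tabulate (adj G x) y) xy)))

  ∣clique∣≤1+Δ : ∀ {Q} → IsClique G Q → ∣ Q ∣ ≤ suc Δ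
  ∣clique∣≤1+Δ {Q} clique with nonempty? Q
  ... | yes (x , x∈Q) = ℕ.≤-trans (p⊆q⇒∣p∣≤∣q∣ Q⊆N[x]) (∣closedNbhd∣≤1+Δ x)
    where
    Q⊆N[x] : Q ⊆ closedNbhd x
    Q⊆N[x] {y} y∈Q with x Fin.≟ y
    ... | yes x≡y = ∈closedNbhd (inj₁ x≡y)
    ... | no  x≢y = ∈closedNbhd (inj₂ (clique x∈Q y∈Q x≢y))
  ... | no  empty = ℕ.≤-trans (ℕ.≤-reflexive (∣Empty∣≡0 empty)) z≤n

module _ {T : Tree} {S : Fin (suc (m T)) → Set} where

  TreeAdj-sym : ∀ {s t} → TreeAdj T s t → TreeAdj T t s
  TreeAdj-sym (inj₁ st) = inj₂ st
  TreeAdj-sym (inj₂ ts) = inj₁ ts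

  walk-start : ∀ {s t} → WalkIn T S s t → S s
  walk-start (here Ss)     = Ss
  walk-start (step Ss _ _) = Ss

  walk-reverse : ∀ {s t} → WalkIn T S s t → WalkIn T S t s
  walk-reverse w = reverse-onto w (here (walk-start w))
    where
    reverse-onto : ∀ {s t u} → WalkIn T S s t → WalkIn T S s u → WalkIn T S t u
    reverse-onto (here _)         acc = acc
    reverse-onto (step _ st walk) acc =
      reverse-onto walk (step (walk-start walk) (TreeAdj-sym st) acc)

pathTree : ℕ → Tree
pathTree n = record { m = n ; parent = inject₁ ; parent≤ = ℕ.≤-reflexive ∘ Fin.toℕ-inject₁ }

Convex : ∀ {n} → (Fin n → Set) → Set
Convex S = ∀ {s t u} → s Fin.≤ t → t Fin.≤ u → S s → S u → S t

module _ {n} {S : Fin (suc n) → Set} (convex : Convex S) where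

  walk-down-path : ∀ {s u} → s Fin.≤ u → S s → S u → WalkIn (pathTree n) S u s
  walk-down-path {s} {u} s≤u Ss = <-weakInduction P base next u s≤u
    where
    P : Fin (suc n) → Set
    P u = s Fin.≤ u → S u → WalkIn (pathTree n) S u s
    base : P zero
    base s≤0 S0 with refl ← Fin.≤-antisym {i = s} s≤0 z≤n = here S0
    next : ∀ i → P (inject₁ i) → P (suc i)
    next i ih s≤1+i S1+i with s Fin.≟ suc i
    ... | yes refl = here S1+i
    ... | no  s≢1+i = step S1+i (inj₁ (i , refl , refl)) (ih s≤i (convex s≤i i≤1+i Ss S1+i))
      where
      i≤1+i : inject₁ i Fin.≤ suc i
      i≤1+i = ℕ.≤-trans (ℕ.≤-reflexive (Fin.toℕ-inject₁ i)) (ℕ.n≤1+n _)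
      s≤i : s Fin.≤ inject₁ i
      s≤i = ℕ.≤-trans (ℕ.≤-pred (Fin.≤∧≢⇒< s≤1+i s≢1+i)) (ℕ.≤-reflexive (≡.sym (Fin.toℕ-inject₁ i)))

  convex⇒connectedIn-path : ConnectedIn (pathTree n) S
  convex⇒connectedIn-path s t Ss St with Fin.≤-total s t
  ... | inj₁ s≤t = walk-reverse (walk-down-path s≤t Ss St)
  ... | inj₂ t≤s = walk-down-path t≤s St Ss

pathDecomposition : (G : Graph) {n : ℕ} {B : Fin (suc n) → Fin (size G) → Set} →
                    (∀ t x → Dec (B t x)) →
                    (∀ x → ∃ λ t → B t x) →
                    (∀ x y → Adj G x y → ∃ λ t → B t x × B t y) →
                    (∀ x → Convex (λ t → B t x)) →
                    TreeDecomposition G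
pathDecomposition G {n} B? cover edge convex = record
  { tree     = pathTree n
  ; bag      = λ t → subset (B? t)
  ; covers   = λ x → let t , Btx = cover x in t , lookup-subset⁺ (B? t) Btx
  ; edges    = λ x y xy → let t , Btx , Bty = edge x y xy in
                 t , lookup-subset⁺ (B? t) Btx , lookup-subset⁺ (B? t) Bty
  ; coherent = λ x → convex⇒connectedIn-path λ s≤t t≤u Bs Bu →
                 lookup-subset⁺ (B? _) (convex x s≤t t≤u (lookup-subset⁻ (B? _) Bs) (lookup-subset⁻ (B? _) Bu))
  }

treewidth-empty : (G : Graph) → ¬ Fin (size G) → ∀ w → TreewidthAtMost G w
treewidth-empty G noVertex w =
  D , λ t → ℕ.≤-trans (ℕ.≤-reflexive (∣Empty∣≡0 {p = bag D t} (noVertex ∘ proj₁))) z≤n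
  where
  D : TreeDecomposition G
  D = pathDecomposition G {n = 0} {B = λ _ _ → Empty.⊥} (λ _ _ → no λ ())
        (λ x → contradiction x noVertex) (λ x → contradiction x noVertex) (λ x → contradiction x noVertex)

injective⇒surjective : ∀ {n} {f : Fin n → Fin n} → Injective _≡_ _≡_ f → ∀ t → ∃ λ v → f v ≡ t
injective⇒surjective {suc n} {f} f-injective t with Fin.any? (λ v → f v Fin.≟ t)
... | yes hit  = hit
... | no  miss = contradiction (Fin.injective⇒≤ g-injective) ℕ.1+n≰n
  where
  t≢f : ∀ v → t ≢ f v
  t≢f v t≡fv = miss (v , ≡.sym t≡fv)
  g-injective : Injective _≡_ _≡_ (λ v → punchOut (t≢f v))
  g-injective = f-injective ∘ Fin.punchOut-injective (t≢f _) (t≢f _)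

module Rank {c ℓ₁ ℓ₂} (O : DecTotalOrder c ℓ₁ ℓ₂) {n}
            (f : Fin n → DecTotalOrder.Carrier O)
            (f-injective : ∀ {u v} → DecTotalOrder._≈_ O (f u) (f v) → u ≡ v) where

  open DecTotalOrder O using (antisym) renaming (_≤_ to _≼_; _≤?_ to _≼?_; refl to ≼-refl; trans to ≼-trans; total to ≼-total)

  _≺_ : Fin n → Fin n → Set ℓ₂
  u ≺ v = f u ≼ f v × u ≢ v

  _≺?_ : ∀ u v → Dec (u ≺ v)
  u ≺? v = (f u ≼? f v) ×-dec ¬? (u Fin.≟ v)

  ≺-trans : ∀ {u v w} → u ≺ v → v ≺ w → u ≺ w
  ≺-trans (uv , u≢v) (vw , _) = ≼-trans uv vw , λ { refl → u≢v (f-injective (antisym uv vw)) }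

  ≺-total : ∀ {u v} → u ≢ v → u ≺ v ⊎ v ≺ u
  ≺-total {u} {v} u≢v with ≼-total (f u) (f v)
  ... | inj₁ uv = inj₁ (uv , u≢v)
  ... | inj₂ vu = inj₂ (vu , u≢v ∘ ≡.sym)

  predecessors : Fin n → Subset n
  predecessors v = subset (_≺? v)

  predecessors-⊂ : ∀ {u v} → u ≺ v → predecessors u ⊂ predecessors v
  predecessors-⊂ {u} {v} u≺v =
      (λ w∈ → ∈-subset⁺ (_≺? v) (≺-trans (∈-subset⁻ (_≺? u) w∈) u≺v))
    , u , ∈-subset⁺ (_≺? v) u≺v , λ u∈ → proj₂ (∈-subset⁻ (_≺? u) u∈) refl

  ∣predecessors∣<n : ∀ v → ∣ predecessors v ∣ ℕ.< n
  ∣predecessors∣<n v = subst (∣ predecessors v ∣ ℕ.<_) (∣⊤∣≡n n)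
    (p⊂q⇒∣p∣<∣q∣ (⊆⊤ , v , ∈⊤ , λ v∈ → proj₂ (∈-subset⁻ (_≺? v) v∈) refl))

  rank : Fin n → Fin n
  rank v = fromℕ< (∣predecessors∣<n v)

  rank-mono : ∀ {u v} → u ≺ v → rank u Fin.< rank v
  rank-mono {u} {v} u≺v = ≡.subst₂ ℕ._<_
    (≡.sym (Fin.toℕ-fromℕ< (∣predecessors∣<n u))) (≡.sym (Fin.toℕ-fromℕ< (∣predecessors∣<n v)))
    (p⊂q⇒∣p∣<∣q∣ (predecessors-⊂ u≺v))

  rank-injective : Injective _≡_ _≡_ rank
  rank-injective {u} {v} ru≡rv with u Fin.≟ v
  ... | yes u≡v = u≡v
  ... | no  u≢v with ≺-total u≢v
  ...   | inj₁ u≺v = contradiction (cong toℕ ru≡rv) (ℕ.<⇒≢ (rank-mono u≺v))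
  ...   | inj₂ v≺u = contradiction (cong toℕ ru≡rv) (ℕ.>⇒≢ (rank-mono v≺u))

  rank-reflects-≼ : ∀ {u v} → rank u Fin.≤ rank v → f u ≼ f v
  rank-reflects-≼ {u} {v} ru≤rv with u Fin.≟ v
  ... | yes refl = ≼-refl
  ... | no  u≢v with ≺-total u≢v
  ...   | inj₁ (uv , _) = uv
  ...   | inj₂ v≺u      = contradiction ru≤rv (ℕ.<⇒≱ (rank-mono v≺u))

  rank-surjective : ∀ t → ∃ λ v → rank v ≡ t
  rank-surjective = injective⇒surjective rank-injective

module Thickening (G : Graph) {Δ} (deg : MaxDegreeAtMost G Δ)
  {n} {AdjH : Fin n → Fin n → Set} (AdjH? : Decidable AdjH)
  {F : Fin n → Fin n → Set} (F-valid : Valid F) (F⊆AdjH : ∀ {u v} → PairIn F u v → AdjH u v)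
  (φ : Fin (size G) → Fin n)
  (nonempty : ∀ v → ∃ λ x → φ x ≡ v)
  (clique : ∀ x y → x ≢ y → φ x ≡ φ y → Adj G x y)
  (complete : ∀ x y → φ x ≢ φ y → AdjH (φ x) (φ y) → ¬ PairIn F (φ x) (φ y) → Adj G x y)
  (anticomplete : ∀ x y → φ x ≢ φ y → ¬ AdjH (φ x) (φ y) → ¬ PairIn F (φ x) (φ y) → ¬ Adj G x y)
  where

  open BoundedDegree G deg

  _∈N[_] : Fin n → Fin n → Set
  w ∈N[ v ] = v ≡ w ⊎ AdjH v w

  _∈N?[_] : ∀ w v → Dec (w ∈N[ v ])
  w ∈N?[ v ] = (v Fin.≟ w) ⊎-dec AdjH? v w

  Adj⇒∈N : ∀ {x y} → Adj G x y → φ y ∈N[ φ x ]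
  Adj⇒∈N {x} {y} xy with φ x Fin.≟ φ y | AdjH? (φ x) (φ y)
  ... | yes φx≡φy | _         = inj₁ φx≡φy
  ... | no  _     | yes φxφy  = inj₂ φxφy
  ... | no  φx≢φy | no  ¬φxφy = contradiction xy (anticomplete x y φx≢φy ¬φxφy (¬φxφy ∘ F⊆AdjH))

  X[N[_]] : Fin n → Subset (size G)
  X[N[ v ]] = subset λ x → φ x ∈N?[ v ]

  ∣X[N[v]]∣≤2+2Δ : ∀ v → ∣ X[N[ v ]] ∣ ≤ suc Δ + suc Δ
  ∣X[N[v]]∣≤2+2Δ v with nonempty v
  ... | x₀ , refl = begin
    ∣ X[N[ φ x₀ ]] ∣           ≤⟨ p⊆q⇒∣p∣≤∣q∣ split ⟩
    ∣ closedNbhd x₀ ∪ Q ∣      ≤⟨ ∣p∪q∣≤∣p∣+∣q∣ (closedNbhd x₀) Q ⟩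
    ∣ closedNbhd x₀ ∣ + ∣ Q ∣  ≤⟨ ℕ.+-mono-≤ (∣closedNbhd∣≤1+Δ x₀) (∣clique∣≤1+Δ Q-clique) ⟩
    suc Δ + suc Δ              ∎
    where
    open ℕ.≤-Reasoning

    Far : Fin (size G) → Set
    Far y = φ y ∈N[ φ x₀ ] × x₀ ≢ y × ¬ Adj G x₀ y

    Far? : ∀ y → Dec (Far y)
    Far? y = (φ y ∈N?[ φ x₀ ]) ×-dec ¬? (x₀ Fin.≟ y) ×-dec ¬? (adj G x₀ y Data.Bool.≟ true)

    Q : Subset (size G)
    Q = subset Far?

    split : X[N[ φ x₀ ]] ⊆ closedNbhd x₀ ∪ Q
    split {y} y∈ with x₀ Fin.≟ y | adj G x₀ y Data.Bool.≟ true
    ... | yes x₀≡y | _       = x∈p∪q⁺ (inj₁ (∈closedNbhd (inj₁ x₀≡y)))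
    ... | no  _    | yes x₀y = x∈p∪q⁺ (inj₁ (∈closedNbhd (inj₂ x₀y)))
    ... | no  x₀≢y | no ¬x₀y = x∈p∪q⁺ (inj₂ (∈-subset⁺ Far? (∈-subset⁻ (λ x → φ x ∈N?[ φ x₀ ]) y∈ , x₀≢y , ¬x₀y)))

    paired : ∀ {y} → Far y → ¬ ¬ PairIn F (φ x₀) (φ y)
    paired {y} (y∈N , x₀≢y , ¬x₀y) ¬pair with φ x₀ Fin.≟ φ y | y∈N
    ... | yes φx₀≡φy | _        = ¬x₀y (clique x₀ y x₀≢y φx₀≡φy)
    ... | no  φx₀≢φy | inj₁ φx₀≡φy = φx₀≢φy φx₀≡φy
    ... | no  φx₀≢φy | inj₂ x₀~y   = ¬x₀y (complete x₀ y φx₀≢φy x₀~y ¬pair)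

    Q-clique : IsClique G Q
    Q-clique {a} {b} a∈ b∈ a≢b with φ a Fin.≟ φ b
    ... | yes φa≡φb = clique a b a≢b φa≡φb
    ... | no  φa≢φb = Empty.⊥-elim (paired (∈-subset⁻ Far? a∈) λ pa →
                        paired (∈-subset⁻ Far? b∈) λ pb → φa≢φb (F-valid _ _ _ pa pb))

-- Before p x y: starting at p and going round the circle, x is reached no later than y.
data Before (p : ℚ) : ℚ → ℚ → Set where
  upper : ∀ {x y} → p ≤ℚ x → x ≤ℚ y → Before p x y
  lower : ∀ {x y} → y <ℚ p → x ≤ℚ y → Before p x y
  wrap  : ∀ {x y} → p ≤ℚ x → y <ℚ p → Before p x y

<⇒≱ : ∀ {x y} → x <ℚ y → ¬ y ≤ℚ x
<⇒≱ x<y y≤x = ℚ.<-irrefl refl (ℚ.<-≤-trans x<y y≤x)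

module _ {p : ℚ} where

  Before-refl : ∀ x → Before p x x
  Before-refl x with p ℚ.≤? x
  ... | yes p≤x = upper p≤x ℚ.≤-refl
  ... | no  p≰x = lower (ℚ.≰⇒> p≰x) ℚ.≤-refl

  Before-trans : Transitive (Before p)
  Before-trans (upper px xy) (upper _ yz)  = upper px (ℚ.≤-trans xy yz)
  Before-trans (upper px _)  (lower zp _)  = wrap px zp
  Before-trans (upper px _)  (wrap _ zp)   = wrap px zp
  Before-trans (lower _ xy)  (lower zp yz) = lower zp (ℚ.≤-trans xy yz)
  Before-trans (lower yp _)  (upper py _)  = contradiction py (<⇒≱ yp)
  Before-trans (lower yp _)  (wrap py _)   = contradiction py (<⇒≱ yp)
  Before-trans (wrap px _)   (lower zp _)  = wrap px zp
  Before-trans (wrap _ yp)   (upper py _)  = contradiction py (<⇒≱ yp)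
  Before-trans (wrap _ yp)   (wrap py _)   = contradiction py (<⇒≱ yp)

  Before-antisym : Antisymmetric _≡_ (Before p)
  Before-antisym (upper _ xy)  (upper _ yx) = ℚ.≤-antisym xy yx
  Before-antisym (lower _ xy)  (lower _ yx) = ℚ.≤-antisym xy yx
  Before-antisym (upper px _)  (lower xp _) = contradiction px (<⇒≱ xp)
  Before-antisym (upper px _)  (wrap _ xp)  = contradiction px (<⇒≱ xp)
  Before-antisym (lower yp _)  (upper py _) = contradiction py (<⇒≱ yp)
  Before-antisym (lower yp _)  (wrap py _)  = contradiction py (<⇒≱ yp)
  Before-antisym (wrap _ yp)   (upper py _) = contradiction py (<⇒≱ yp)
  Before-antisym (wrap px _)   (lower xp _) = contradiction px (<⇒≱ xp)
  Before-antisym (wrap _ yp)   (wrap py _)  = contradiction py (<⇒≱ yp)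

  Before-total : Total (Before p)
  Before-total x y with p ℚ.≤? x | p ℚ.≤? y | ℚ.≤-total x y
  ... | yes px | yes _  | inj₁ xy = inj₁ (upper px xy)
  ... | yes _  | yes py | inj₂ yx = inj₂ (upper py yx)
  ... | yes px | no  py | _       = inj₁ (wrap px (ℚ.≰⇒> py))
  ... | no  px | yes py | _       = inj₂ (wrap py (ℚ.≰⇒> px))
  ... | no  _  | no  py | inj₁ xy = inj₁ (lower (ℚ.≰⇒> py) xy)
  ... | no  px | no  _  | inj₂ yx = inj₂ (lower (ℚ.≰⇒> px) yx)

  Before? : Decidable (Before p)
  Before? x y with p ℚ.≤? x | p ℚ.≤? y | x ℚ.≤? y
  ... | yes px | _      | yes xy  = yes (upper px xy)
  ... | yes px | no  py | no  _   = yes (wrap px (ℚ.≰⇒> py))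
  ... | no  _  | no  py | yes xy  = yes (lower (ℚ.≰⇒> py) xy)
  ... | yes _  | yes py | no  x≰y = no λ
    { (upper _ xy) → x≰y xy ; (lower yp _) → <⇒≱ yp py ; (wrap _ yp) → <⇒≱ yp py }
  ... | no  px | yes py | _       = no λ
    { (upper px′ _) → px px′ ; (lower yp _) → <⇒≱ yp py ; (wrap px′ _) → px px′ }
  ... | no  px | no  _  | no  x≰y = no λ
    { (upper px′ _) → px px′ ; (lower _ xy) → x≰y xy ; (wrap px′ _) → px px′ }

cutOrder : ℚ → DecTotalOrder 0ℓ 0ℓ 0ℓ
cutOrder p = record
  { Carrier         = ℚ
  ; _≈_             = _≡_
  ; _≤_             = Before p
  ; isDecTotalOrder = record
    { isTotalOrder = record
      { isPartialOrder = record
        { isPreorder = record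
          { isEquivalence = ≡.isEquivalence
          ; reflexive     = λ { refl → Before-refl _ }
          ; trans         = Before-trans
          }
        ; antisym = Before-antisym
        }
      ; total = Before-total
      }
    ; _≟_  = ℚ._≟_
    ; _≤?_ = Before?
    }
  }

module _ {p a b : ℚ} where

  InArc⇒Before : ∀ {x} → ¬ InArc a b p → InArc a b x → Before p a x × Before p x b
  InArc⇒Before p∉ab (inj₁ (ax , xb)) with p ℚ.≤? a | p ℚ.≤? b
  ... | yes pa | _      = upper pa ax , upper (ℚ.≤-trans pa ax) xb
  ... | no  pa | yes pb = contradiction (inj₁ (ℚ.<⇒≤ (ℚ.≰⇒> pa) , pb)) p∉ab
  ... | no  _  | no  pb = lower (ℚ.≤-<-trans xb (ℚ.≰⇒> pb)) ax , lower (ℚ.≰⇒> pb) xb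
  InArc⇒Before p∉ab (inj₂ (ba , a≤x⊎x≤b)) with p ℚ.≤? a | p ℚ.≤? b
  ... | no  pa | _      = contradiction (inj₂ (ba , inj₁ (ℚ.<⇒≤ (ℚ.≰⇒> pa)))) p∉ab
  ... | yes _  | yes pb = contradiction (inj₂ (ba , inj₂ pb)) p∉ab
  ... | yes pa | no  pb with a≤x⊎x≤b
  ...   | inj₁ ax = upper pa ax , wrap (ℚ.≤-trans pa ax) (ℚ.≰⇒> pb)
  ...   | inj₂ xb = wrap pa (ℚ.≤-<-trans xb (ℚ.≰⇒> pb)) , lower (ℚ.≰⇒> pb) xb

  Before⇒InArc : ∀ {x} → Before p a x → Before p x b → InArc a b x
  Before⇒InArc (upper _ ax)  (upper _ xb)  = inj₁ (ax , xb)
  Before⇒InArc (lower _ ax)  (lower _ xb)  = inj₁ (ax , xb)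
  Before⇒InArc (upper pa ax) (wrap _ bp)   = inj₂ (ℚ.<-≤-trans bp pa , inj₁ ax)
  Before⇒InArc (wrap pa _)   (lower bp xb) = inj₂ (ℚ.<-≤-trans bp pa , inj₂ xb)
  Before⇒InArc (upper pa ax) (lower bp xb) = contradiction (ℚ.≤-trans pa (ℚ.≤-trans ax xb)) (<⇒≱ bp)
  Before⇒InArc (lower xp _)  (upper px _)  = contradiction px (<⇒≱ xp)
  Before⇒InArc (lower xp _)  (wrap px _)   = contradiction px (<⇒≱ xp)
  Before⇒InArc (wrap _ xp)   (upper px _)  = contradiction px (<⇒≱ xp)
  Before⇒InArc (wrap _ xp)   (wrap px _)   = contradiction px (<⇒≱ xp)

  InArc-convex : ∀ {u z w} → ¬ InArc a b p → InArc a b u → InArc a b w →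
                 Before p u z → Before p z w → InArc a b z
  InArc-convex p∉ab u∈ab w∈ab uz zw =
    Before⇒InArc (Before-trans (proj₁ (InArc⇒Before p∉ab u∈ab)) uz)
                 (Before-trans zw (proj₂ (InArc⇒Before p∉ab w∈ab)))

InArc? : ∀ a b x → Dec (InArc a b x)
InArc? a b x = ((a ℚ.≤? x) ×-dec (x ℚ.≤? b)) ⊎-dec ((b ℚ.<? a) ×-dec ((a ℚ.≤? x) ⊎-dec (x ℚ.≤? b)))

InArc-left : ∀ a b → InArc a b a
InArc-left a b with a ℚ.≤? b
... | yes ab = inj₁ (ℚ.≤-refl , ab)
... | no  ab = inj₂ (ℚ.≰⇒> ab , inj₁ ℚ.≤-refl)

InArc-right : ∀ a b → InArc a b b
InArc-right a b with a ℚ.≤? b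
... | yes ab = inj₁ (ab , ℚ.≤-refl)
... | no  ab = inj₂ (ℚ.≰⇒> ab , inj₂ ℚ.≤-refl)

module _ {n} (M : LongCircularIntervalModel n) where

  AdjH? : Decidable (AdjH M)
  AdjH? u v = ¬? (u Fin.≟ v) ×-dec Fin.any? λ i →
    InArc? (left M i) (right M i) (pos M u) ×-dec InArc? (left M i) (right M i) (pos M v)

  shared-arc : ∀ {u v} i → InI M i u → InI M i v → u ≡ v ⊎ AdjH M u v
  shared-arc {u} {v} i u∈i v∈i with u Fin.≟ v
  ... | yes u≡v = inj₁ u≡v
  ... | no  u≢v = inj₂ (u≢v , i , u∈i , v∈i)

  AdjH-sym : Symmetric (AdjH M)
  AdjH-sym (u≢v , i , u∈i , v∈i) = u≢v ∘ ≡.sym , i , v∈i , u∈i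

  InF'⇒AdjH : ∀ {u v} → InF' M u v → AdjH M u v
  InF'⇒AdjH {u} {v} (u≢v , i , ends , _) = u≢v , i , endpoints ends
    where
    arc : ℚ → Set
    arc = InArc (left M i) (right M i)
    endpoints : (pos M u ≡ left M i × pos M v ≡ right M i) ⊎ (pos M u ≡ right M i × pos M v ≡ left M i) →
                arc (pos M u) × arc (pos M v)
    endpoints (inj₁ (u≡l , v≡r)) = subst arc (≡.sym u≡l) (InArc-left _ _) , subst arc (≡.sym v≡r) (InArc-right _ _)
    endpoints (inj₂ (u≡r , v≡l)) = subst arc (≡.sym u≡r) (InArc-right _ _) , subst arc (≡.sym v≡l) (InArc-left _ _)

[1+d+1+d]+[1+d+1+d]≡4d+3+1 : ∀ d → suc d + suc d + (suc d + suc d) ≡ 4 * d + 3 + 1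
[1+d+1+d]+[1+d+1+d]≡4d+3+1 = solve-∀

module FuzzyLongCircularInterval
  (G : Graph) {Δ} (deg : MaxDegreeAtMost G Δ)
  {n} (M : LongCircularIntervalModel (suc n))
  {F : Fin (suc n) → Fin (suc n) → Set} (F⊆F' : ∀ u v → F u v → InF' M u v) (F-valid : Valid F)
  (φ : Fin (size G) → Fin (suc n))
  (nonempty : ∀ v → ∃ λ x → φ x ≡ v)
  (clique : ∀ x y → x ≢ y → φ x ≡ φ y → Adj G x y)
  (complete : ∀ x y → φ x ≢ φ y → AdjH M (φ x) (φ y) → ¬ PairIn F (φ x) (φ y) → Adj G x y)
  (anticomplete : ∀ x y → φ x ≢ φ y → ¬ AdjH M (φ x) (φ y) → ¬ PairIn F (φ x) (φ y) → ¬ Adj G x y)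
  where

  F⊆AdjH : ∀ {u v} → PairIn F u v → AdjH M u v
  F⊆AdjH (inj₁ uFv) = InF'⇒AdjH M (F⊆F' _ _ uFv)
  F⊆AdjH (inj₂ vFu) = AdjH-sym M (InF'⇒AdjH M (F⊆F' _ _ vFu))

  open Thickening G deg (AdjH? M) F-valid F⊆AdjH φ nonempty clique complete anticomplete

  v₀ : Fin (suc n)
  v₀ = zero

  open Rank (cutOrder (pos M v₀)) (pos M) (posInj M _ _)

  Spans : Fin (suc n) → Fin (suc n) → Set
  Spans t u = rank u Fin.≤ t × ∃ λ w → w ∈N[ u ] × t Fin.≤ rank w

  Spans? : ∀ t u → Dec (Spans t u)
  Spans? t u = (rank u Fin.≤? t) ×-dec Fin.any? λ w → (w ∈N?[ u ]) ×-dec (t Fin.≤? rank w)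

  Bag : Fin (suc n) → Fin (size G) → Set
  Bag t x = φ x ∈N[ v₀ ] ⊎ Spans t (φ x)

  Bag? : ∀ t x → Dec (Bag t x)
  Bag? t x = (φ x ∈N?[ v₀ ]) ⊎-dec Spans? t (φ x)

  Spans-nbr : ∀ {u w} → w ∈N[ u ] → rank u Fin.≤ rank w → Spans (rank w) u
  Spans-nbr w∈N ru≤rw = ru≤rw , _ , w∈N , Fin.≤-refl

  Spans-rank : ∀ u → Spans (rank u) u
  Spans-rank u = Spans-nbr (inj₁ refl) Fin.≤-refl

  Bag-cover : ∀ x → ∃ λ t → Bag t x
  Bag-cover x = rank (φ x) , inj₂ (Spans-rank (φ x))

  Bag-edge : ∀ x y → Adj G x y → ∃ λ t → Bag t x × Bag t y
  Bag-edge x y xy with Fin.≤-total (rank (φ x)) (rank (φ y))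
  ... | inj₁ rx≤ry = rank (φ y) , inj₂ (Spans-nbr (Adj⇒∈N xy) rx≤ry) , inj₂ (Spans-rank (φ y))
  ... | inj₂ ry≤rx = rank (φ x) , inj₂ (Spans-rank (φ x)) , inj₂ (Spans-nbr (Adj⇒∈N (Adj-sym G xy)) ry≤rx)

  Bag-convex : ∀ x → Convex (λ t → Bag t x)
  Bag-convex x _   _   (inj₁ x∈N) _ = inj₁ x∈N
  Bag-convex x _   _   _ (inj₁ x∈N) = inj₁ x∈N
  Bag-convex x s≤t t≤u (inj₂ (rx≤s , _)) (inj₂ (_ , w , w∈N , u≤rw)) =
    inj₂ (Fin.≤-trans rx≤s s≤t , w , w∈N , Fin.≤-trans t≤u u≤rw)

  Spans⇒∈N : ∀ {t u v} → ¬ u ∈N[ v₀ ] → Spans t u → rank v ≡ t → u ∈N[ v ]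
  Spans⇒∈N u∉N (ru≤rv , _ , inj₁ refl , rv≤ru) refl = inj₁ (rank-injective (Fin.≤-antisym rv≤ru ru≤rv))
  Spans⇒∈N u∉N (ru≤rv , w , inj₂ (_ , i , u∈i , w∈i) , rv≤rw) refl =
    shared-arc M i (InArc-convex v₀∉i u∈i w∈i (rank-reflects-≼ ru≤rv) (rank-reflects-≼ rv≤rw)) u∈i
    where
    v₀∉i : ¬ InI M i v₀
    v₀∉i v₀∈i = u∉N (shared-arc M i v₀∈i u∈i)

  decomposition : TreeDecomposition G
  decomposition = pathDecomposition G Bag? Bag-cover Bag-edge Bag-convex

  bag⊆X[N[v₀]]∪X[N[v]] : ∀ {t v} → rank v ≡ t → bag decomposition t ⊆ X[N[ v₀ ]] ∪ X[N[ v ]]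
  bag⊆X[N[v₀]]∪X[N[v]] {t} {v} rv≡t {x} x∈ with ∈-subset⁻ (Bag? t) x∈ | φ x ∈N?[ v₀ ]
  ... | inj₁ x∈N  | _       = x∈p∪q⁺ (inj₁ (∈-subset⁺ (λ y → φ y ∈N?[ v₀ ]) x∈N))
  ... | inj₂ _    | yes x∈N = x∈p∪q⁺ (inj₁ (∈-subset⁺ (λ y → φ y ∈N?[ v₀ ]) x∈N))
  ... | inj₂ span | no  x∉N = x∈p∪q⁺ (inj₂ (∈-subset⁺ (λ y → φ y ∈N?[ v ]) (Spans⇒∈N x∉N span rv≡t)))

  width≤4Δ+3 : WidthAtMost decomposition (4 * Δ + 3)
  width≤4Δ+3 t with v , rv≡t ← rank-surjective t = begin
    ∣ bag decomposition t ∣             ≤⟨ p⊆q⇒∣p∣≤∣q∣ (bag⊆X[N[v₀]]∪X[N[v]] rv≡t) ⟩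
    ∣ X[N[ v₀ ]] ∪ X[N[ v ]] ∣          ≤⟨ ∣p∪q∣≤∣p∣+∣q∣ X[N[ v₀ ]] X[N[ v ]] ⟩
    ∣ X[N[ v₀ ]] ∣ + ∣ X[N[ v ]] ∣       ≤⟨ ℕ.+-mono-≤ (∣X[N[v]]∣≤2+2Δ v₀) (∣X[N[v]]∣≤2+2Δ v) ⟩
    (suc Δ + suc Δ) + (suc Δ + suc Δ)   ≡⟨ [1+d+1+d]+[1+d+1+d]≡4d+3+1 Δ ⟩
    4 * Δ + 3 + 1                       ∎
    where open ℕ.≤-Reasoning

theorem3p3 : (Δ : ℕ) → 1 ≤ Δ → (G : Graph) →
    FuzzyLongCircularIntervalGraph G → MaxDegreeAtMost G Δ →
    TreewidthAtMost G (4 * Δ + 3)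
-- The bound also holds for Δ = 0.
theorem3p3 Δ _ G (zero , _ , _ , _ , _ , φ , _) _ = treewidth-empty G (Fin.¬Fin0 ∘ φ) (4 * Δ + 3)
theorem3p3 Δ _ G (suc n , M , F , F⊆F' , F-valid , φ , nonempty , clique , complete , anticomplete , _) deg =
  decomposition , width≤4Δ+3
  where open FuzzyLongCircularInterval G deg M F⊆F' F-valid φ nonempty clique complete anticomplete
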